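{- Let $t$ be a positive integer. There exists no Hadamard matrix of order $16t$ such that every quadruple of distinct rows has type $t$ or $2t$.
   Context: A Hadamard matrix of order $n$ is an $n\times n$ matrix $H=(h_{uv})$ with entries in $\{ -1,1\}$ such that $HH^\top=nI$. For four distinct rows $i,j,k,\ell$ of $H$, put $P_{ijk\ell}=\left|\sum_{r=1}^n h_{ir}h_{jr}h_{kr}h_{\ell r}\right|$; the type of the quadruple $\{i,j,k,\ell\}$ is $T_{ijk\ell}=\frac{n-P_{ijk\ell}}{8}$. -}

module Defs where

import Data.Nat
open import Data.Nat using (ℕ; suc)
import Data.Fin
open import Data.Fin using (Fin; _≟_)
open import Data.Integer using (ℤ; +_; _-_; ∣_∣) renaming (_*_ to _*ℤ_; _+_ to _+ℤ_)
open import Data.Product using (_×_)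
open import Data.Sum using (_⊎_)
open import Relation.Binary.PropositionalEquality using (_≡_; _≢_)
open import Relation.Nullary using (yes; no)
open import Data.Integer using (-_)

Matrix : ℕ → Set
Matrix n = Fin n → Fin n → ℤ

Σ : (n : ℕ) → (Fin n → ℤ) → ℤ
Σ ℕ.zero f = + 0
Σ (suc n) f = f Fin.zero +ℤ Σ n (λ r → f (Fin.suc r))

scaledId : (n : ℕ) → Fin n → Fin n → ℤ
scaledId n i j with i ≟ j
... | yes _ = + n
... | no _ = + 0

IsHadamard : (n : ℕ) → Matrix n → Set
IsHadamard n H =
  (∀ u v → (H u v ≡ + 1) ⊎ (H u v ≡ - (+ 1)))
  × (∀ i j → Σ n (λ r → H i r *ℤ H j r) ≡ scaledId n i j)

P : (n : ℕ) → Matrix n → (i j k l : Fin n) → ℕ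
P n H i j k l = ∣ Σ n (λ r → H i r *ℤ H j r *ℤ H k r *ℤ H l r) ∣

Distinct4 : {n : ℕ} → (i j k l : Fin n) → Set
Distinct4 i j k l =
  i ≢ j × i ≢ k × i ≢ l × j ≢ k × j ≢ l × k ≢ l

-- the quadruple {i,j,k,l} has type T, i.e. T = (n - P)/8, i.e. n - P = 8 T
HasType : (n : ℕ) → Matrix n → (i j k l : Fin n) → ℕ → Set
HasType n H i j k l T = (+ n) - (+ P n H i j k l) ≡ + (8 Data.Nat.* T)

-- Take three distinct rows i, j, k and let x be their entrywise product, so that
-- (Hx)_l = ±P_{ijkl}.  This vanishes for l ∈ {i, j, k}, and the hypothesis makes
-- ∣(Hx)_l∣ ∈ {8t, 0} otherwise; thus Hx = 8t·e with e ∈ {0, ±1}ⁿ.  Since HᵀH = nI,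
-- Parseval gives 64t²⟨e, e⟩ = ⟨Hx, Hx⟩ = n⟨x, x⟩ = n², so e has exactly four nonzero
-- entries, at rows a₀, …, a₃, and inverting gives Hᵀe = 2x.  In each column r the four
-- terms e_{a_q} H_{a_q r} are ±1 with sum ±2, so their product is −1; hence the product
-- of the rows a₀, …, a₃ is the constant vector −∏ e_{a_q}, and this quadruple has
-- P = n, i.e. type 0.

module Submission where

open import Defs
import Data.Nat
open import Data.Nat using (ℕ; suc; _*_)
open import Data.Fin using (Fin)
open import Data.Product using (Σ-syntax; _×_)
open import Data.Sum using (_⊎_)
open import Relation.Nullary using (¬_)

open import Data.Empty using (⊥-elim)
open import Data.Fin using (zero; suc; _≟_)
open import Data.Fin.Patterns using (0F; 1F; 2F; 3F)
import Data.Fin.Properties as Fin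
open import Data.Integer using (ℤ; +_; -_; ∣_∣; 0ℤ; 1ℤ; -1ℤ; +0; +[1+_]; -[1+_]; _-_; +≤+) renaming (_*_ to _*ℤ_; _+_ to _+ℤ_; _≤_ to _≤ℤ_)
import Data.Integer.Properties as ℤ
open import Data.Integer.Solver using (module +-*-Solver)
open import Data.Nat using (_+_; _≤_; z≤n; s≤s; NonZero; >-nonZero; ≢-nonZero⁻¹)
import Data.Nat.Properties as ℕ
open import Data.Product using (_,_; proj₁; proj₂; ∃-syntax)
open import Data.Sum using (inj₁; inj₂; [_,_]′)
open import Data.Vec.Functional using (Vector)
open import Function using (_∘_; id)
open import Relation.Binary.PropositionalEquality
open import Relation.Nullary using (yes; no)
open import Algebra.Properties.Semiring.Sum ℤ.+-*-semiring using (sum; sum-cong-≗; ∑-distrib-+; ∑-comm; *-distribˡ-sum)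

open +-*-Solver
open ≡-Reasoning

Σ≡sum : ∀ n (f : Vector ℤ n) → Σ n f ≡ sum f
Σ≡sum 0 f = refl
Σ≡sum (suc n) f = cong (f zero +ℤ_) (Σ≡sum n (f ∘ suc))

Σ-cong : ∀ n {f g : Vector ℤ n} → (∀ r → f r ≡ g r) → Σ n f ≡ Σ n g
Σ-cong n {f} {g} f≗g = trans (Σ≡sum n f) (trans (sum-cong-≗ f≗g) (sym (Σ≡sum n g)))

Σ-distrib-+ : ∀ n (f g : Vector ℤ n) → Σ n (λ r → f r +ℤ g r) ≡ Σ n f +ℤ Σ n g
Σ-distrib-+ n f g = begin
  Σ n (λ r → f r +ℤ g r)  ≡⟨ Σ≡sum n _ ⟩
  sum (λ r → f r +ℤ g r)  ≡⟨ ∑-distrib-+ f g ⟩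
  sum f +ℤ sum g          ≡⟨ sym (cong₂ _+ℤ_ (Σ≡sum n f) (Σ≡sum n g)) ⟩
  Σ n f +ℤ Σ n g          ∎

*-distribˡ-Σ : ∀ n c (f : Vector ℤ n) → c *ℤ Σ n f ≡ Σ n (λ r → c *ℤ f r)
*-distribˡ-Σ n c f = begin
  c *ℤ Σ n f              ≡⟨ cong (c *ℤ_) (Σ≡sum n f) ⟩
  c *ℤ sum f              ≡⟨ *-distribˡ-sum c f ⟩
  sum (λ r → c *ℤ f r)    ≡⟨ sym (Σ≡sum n _) ⟩
  Σ n (λ r → c *ℤ f r)    ∎

Σ-comm : ∀ m n (f : Fin m → Fin n → ℤ) →
         Σ m (λ i → Σ n (λ j → f i j)) ≡ Σ n (λ j → Σ m (λ i → f i j))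
Σ-comm m n f = begin
  Σ m (λ i → Σ n (f i))                 ≡⟨ Σ²≡sum² m n f ⟩
  sum (λ i → sum (f i))                 ≡⟨ ∑-comm f ⟩
  sum (λ j → sum (λ i → f i j))         ≡⟨ sym (Σ²≡sum² n m (λ j i → f i j)) ⟩
  Σ n (λ j → Σ m (λ i → f i j))         ∎
  where
  Σ²≡sum² : ∀ m n (f : Fin m → Fin n → ℤ) → Σ m (λ i → Σ n (f i)) ≡ sum (λ i → sum (f i))
  Σ²≡sum² m n f = trans (Σ≡sum m _) (sum-cong-≗ (λ i → Σ≡sum n (f i)))

Σ-neg : ∀ n (f : Vector ℤ n) → Σ n (λ r → - f r) ≡ - Σ n f
Σ-neg n f = begin
  Σ n (λ r → - f r)        ≡⟨ Σ-cong n (λ r → sym (ℤ.-1*i≡-i (f r))) ⟩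
  Σ n (λ r → -1ℤ *ℤ f r)   ≡⟨ sym (*-distribˡ-Σ n -1ℤ f) ⟩
  -1ℤ *ℤ Σ n f             ≡⟨ ℤ.-1*i≡-i (Σ n f) ⟩
  - Σ n f                  ∎

Σ-sub : ∀ n (f g : Vector ℤ n) → Σ n (λ r → f r - g r) ≡ Σ n f - Σ n g
Σ-sub n f g = trans (Σ-distrib-+ n f (λ r → - g r)) (cong (Σ n f +ℤ_) (Σ-neg n g))

Σ-zero : ∀ n → Σ n (λ _ → 0ℤ) ≡ 0ℤ
Σ-zero 0 = refl
Σ-zero (suc n) = trans (ℤ.+-identityˡ _) (Σ-zero n)

Σ-one : ∀ n → Σ n (λ _ → 1ℤ) ≡ + n
Σ-one 0 = refl
Σ-one (suc n) = cong (1ℤ +ℤ_) (Σ-one n)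

Σ-const : ∀ n c → Σ n (λ _ → c) ≡ c *ℤ + n
Σ-const n c = begin
  Σ n (λ _ → c)           ≡⟨ Σ-cong n (λ _ → ℤ.*-identityʳ c) ⟨
  Σ n (λ _ → c *ℤ 1ℤ)     ≡⟨ *-distribˡ-Σ n c (λ _ → 1ℤ) ⟨
  c *ℤ Σ n (λ _ → 1ℤ)     ≡⟨ cong (c *ℤ_) (Σ-one n) ⟩
  c *ℤ + n                ∎

nonneg-+≡0⇒≡0 : ∀ {i j} → 0ℤ ≤ℤ i → 0ℤ ≤ℤ j → i +ℤ j ≡ 0ℤ → i ≡ 0ℤ × j ≡ 0ℤ
nonneg-+≡0⇒≡0 (+≤+ {n = a} _) (+≤+ {n = b} _) a+b≡0 =
  cong +_ (ℕ.m+n≡0⇒m≡0 a (ℤ.+-injective a+b≡0)) , cong +_ (ℕ.m+n≡0⇒n≡0 a (ℤ.+-injective a+b≡0))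

Σ-nonneg : ∀ n {f : Vector ℤ n} → (∀ r → 0ℤ ≤ℤ f r) → 0ℤ ≤ℤ Σ n f
Σ-nonneg 0 f≥0 = +≤+ z≤n
Σ-nonneg (suc n) f≥0 = ℤ.+-mono-≤ (f≥0 zero) (Σ-nonneg n (f≥0 ∘ suc))

Σ-nonneg≡0 : ∀ n {f : Vector ℤ n} → (∀ r → 0ℤ ≤ℤ f r) → Σ n f ≡ 0ℤ → ∀ r → f r ≡ 0ℤ
Σ-nonneg≡0 (suc n) f≥0 Σf≡0 zero = proj₁ (nonneg-+≡0⇒≡0 (f≥0 zero) (Σ-nonneg n (f≥0 ∘ suc)) Σf≡0)
Σ-nonneg≡0 (suc n) f≥0 Σf≡0 (suc r) =
  Σ-nonneg≡0 n (f≥0 ∘ suc) (proj₂ (nonneg-+≡0⇒≡0 (f≥0 zero) (Σ-nonneg n (f≥0 ∘ suc)) Σf≡0)) r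

square-nonneg : ∀ i → 0ℤ ≤ℤ i *ℤ i
square-nonneg +0 = +≤+ z≤n
square-nonneg +[1+ m ] = +≤+ z≤n
square-nonneg -[1+ m ] = +≤+ z≤n

square≡0 : ∀ {i} → i *ℤ i ≡ 0ℤ → i ≡ 0ℤ
square≡0 {i} i²≡0 = [ id , id ]′ (ℤ.i*j≡0⇒i≡0∨j≡0 i i²≡0)

dot : ∀ {n} → Vector ℤ n → Vector ℤ n → ℤ
dot {n} x y = Σ n (λ r → x r *ℤ y r)

dot-comm : ∀ {n} (x y : Vector ℤ n) → dot x y ≡ dot y x
dot-comm {n} x y = Σ-cong n (λ r → ℤ.*-comm (x r) (y r))

dot-scaleˡ : ∀ {n} c (x y : Vector ℤ n) → dot (λ r → c *ℤ x r) y ≡ c *ℤ dot x y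
dot-scaleˡ {n} c x y =
  trans (Σ-cong n (λ r → ℤ.*-assoc c (x r) (y r))) (sym (*-distribˡ-Σ n c _))

dot-scaleʳ : ∀ {n} c (x y : Vector ℤ n) → dot x (λ r → c *ℤ y r) ≡ c *ℤ dot x y
dot-scaleʳ c x y = trans (dot-comm x _) (trans (dot-scaleˡ c y x) (cong (c *ℤ_) (dot-comm y x)))

dot-subˡ : ∀ {n} (x y z : Vector ℤ n) → dot (λ r → x r - y r) z ≡ dot x z - dot y z
dot-subˡ {n} x y z = trans (Σ-cong n (λ r → distrib (x r) (y r) (z r))) (Σ-sub n _ _)
  where
  distrib : ∀ a b c → (a - b) *ℤ c ≡ a *ℤ c - b *ℤ c
  distrib = solve 3 (λ a b c → (a :- b) :* c := a :* c :- b :* c) refl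

dot-self-nonneg : ∀ {n} (x : Vector ℤ n) → 0ℤ ≤ℤ dot x x
dot-self-nonneg {n} x = Σ-nonneg n (λ r → square-nonneg (x r))

dot-self≡0 : ∀ {n} (x : Vector ℤ n) → dot x x ≡ 0ℤ → ∀ r → x r ≡ 0ℤ
dot-self≡0 {n} x x·x≡0 r = square≡0 (Σ-nonneg≡0 n (λ r → square-nonneg (x r)) x·x≡0 r)

δ : ∀ {n} → Fin n → Fin n → ℤ
δ zero zero = 1ℤ
δ zero (suc _) = 0ℤ
δ (suc _) zero = 0ℤ
δ (suc r) (suc s) = δ r s

δ-refl : ∀ {n} (r : Fin n) → δ r r ≡ 1ℤ
δ-refl zero = refl
δ-refl (suc r) = δ-refl r

δ-≢ : ∀ {n} {r s : Fin n} → r ≢ s → δ r s ≡ 0ℤ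
δ-≢ {r = zero} {zero} r≢s = ⊥-elim (r≢s refl)
δ-≢ {r = zero} {suc s} r≢s = refl
δ-≢ {r = suc r} {zero} r≢s = refl
δ-≢ {r = suc r} {suc s} r≢s = δ-≢ (r≢s ∘ cong suc)

scaledId≡*δ : ∀ n (r s : Fin n) → scaledId n r s ≡ + n *ℤ δ r s
scaledId≡*δ n r s with r ≟ s
... | yes refl = sym (trans (cong (+ n *ℤ_) (δ-refl r)) (ℤ.*-identityʳ (+ n)))
... | no r≢s = sym (trans (cong (+ n *ℤ_) (δ-≢ r≢s)) (ℤ.*-zeroʳ (+ n)))

dot-δˡ : ∀ {n} (r : Fin n) (y : Vector ℤ n) → dot (δ r) y ≡ y r
dot-δˡ {suc n} zero y = trans (cong₂ _+ℤ_ (ℤ.*-identityˡ (y zero)) (Σ-zero n)) (ℤ.+-identityʳ (y zero))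
dot-δˡ {suc n} (suc r) y = trans (ℤ.+-identityˡ _) (dot-δˡ r (y ∘ suc))

dot-δʳ : ∀ {n} (r : Fin n) (y : Vector ℤ n) → dot y (δ r) ≡ y r
dot-δʳ r y = trans (dot-comm y (δ r)) (dot-δˡ r y)

dot-congˡ : ∀ {n} {x y : Vector ℤ n} (z : Vector ℤ n) → (∀ r → x r ≡ y r) → dot x z ≡ dot y z
dot-congˡ {n} z x≗y = Σ-cong n (λ r → cong (_*ℤ z r) (x≗y r))

dot-congʳ : ∀ {n} (x : Vector ℤ n) {y z : Vector ℤ n} → (∀ r → y r ≡ z r) → dot x y ≡ dot x z
dot-congʳ {n} x y≗z = Σ-cong n (λ r → cong (x r *ℤ_) (y≗z r))

dot-zeroʳ : ∀ {n} (x : Vector ℤ n) {y : Vector ℤ n} → (∀ r → y r ≡ 0ℤ) → dot x y ≡ 0ℤ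
dot-zeroʳ {n} x y≡0 = trans (Σ-cong n (λ r → trans (cong (x r *ℤ_) (y≡0 r)) (ℤ.*-zeroʳ (x r)))) (Σ-zero n)

IsUnit : ℤ → Set
IsUnit u = u ≡ 1ℤ ⊎ u ≡ -1ℤ

unit² : ∀ {u} → IsUnit u → u *ℤ u ≡ 1ℤ
unit² (inj₁ refl) = refl
unit² (inj₂ refl) = refl

unit-* : ∀ {u v} → IsUnit u → IsUnit v → IsUnit (u *ℤ v)
unit-* (inj₁ refl) (inj₁ refl) = inj₁ refl
unit-* (inj₁ refl) (inj₂ refl) = inj₂ refl
unit-* (inj₂ refl) (inj₁ refl) = inj₂ refl
unit-* (inj₂ refl) (inj₂ refl) = inj₁ refl

∣unit∣≡1 : ∀ {u} → IsUnit u → ∣ u ∣ ≡ 1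
∣unit∣≡1 (inj₁ refl) = refl
∣unit∣≡1 (inj₂ refl) = refl

unit*≡-1⇒≡-unit : ∀ {u w} → IsUnit u → u *ℤ w ≡ -1ℤ → w ≡ - u
unit*≡-1⇒≡-unit {w = w} (inj₁ refl) uw≡-1 = trans (sym (ℤ.*-identityˡ w)) uw≡-1
unit*≡-1⇒≡-unit {w = w} (inj₂ refl) uw≡-1 =
  trans (sym (ℤ.neg-involutive w)) (cong -_ (trans (sym (ℤ.-1*i≡-i w)) uw≡-1))

units-∣sum∣≡2⇒product≡-1 : ∀ {u₀ u₁ u₂ u₃} → IsUnit u₀ → IsUnit u₁ → IsUnit u₂ → IsUnit u₃ →
  ∣ u₀ +ℤ (u₁ +ℤ (u₂ +ℤ (u₃ +ℤ 0ℤ))) ∣ ≡ 2 → u₀ *ℤ u₁ *ℤ u₂ *ℤ u₃ ≡ -1ℤ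
units-∣sum∣≡2⇒product≡-1 (inj₁ refl) (inj₁ refl) (inj₁ refl) (inj₁ refl) ()
units-∣sum∣≡2⇒product≡-1 (inj₁ refl) (inj₁ refl) (inj₁ refl) (inj₂ refl) _ = refl
units-∣sum∣≡2⇒product≡-1 (inj₁ refl) (inj₁ refl) (inj₂ refl) (inj₁ refl) _ = refl
units-∣sum∣≡2⇒product≡-1 (inj₁ refl) (inj₁ refl) (inj₂ refl) (inj₂ refl) ()
units-∣sum∣≡2⇒product≡-1 (inj₁ refl) (inj₂ refl) (inj₁ refl) (inj₁ refl) _ = refl
units-∣sum∣≡2⇒product≡-1 (inj₁ refl) (inj₂ refl) (inj₁ refl) (inj₂ refl) ()
units-∣sum∣≡2⇒product≡-1 (inj₁ refl) (inj₂ refl) (inj₂ refl) (inj₁ refl) ()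
units-∣sum∣≡2⇒product≡-1 (inj₁ refl) (inj₂ refl) (inj₂ refl) (inj₂ refl) _ = refl
units-∣sum∣≡2⇒product≡-1 (inj₂ refl) (inj₁ refl) (inj₁ refl) (inj₁ refl) _ = refl
units-∣sum∣≡2⇒product≡-1 (inj₂ refl) (inj₁ refl) (inj₁ refl) (inj₂ refl) ()
units-∣sum∣≡2⇒product≡-1 (inj₂ refl) (inj₁ refl) (inj₂ refl) (inj₁ refl) ()
units-∣sum∣≡2⇒product≡-1 (inj₂ refl) (inj₁ refl) (inj₂ refl) (inj₂ refl) _ = refl
units-∣sum∣≡2⇒product≡-1 (inj₂ refl) (inj₂ refl) (inj₁ refl) (inj₁ refl) ()
units-∣sum∣≡2⇒product≡-1 (inj₂ refl) (inj₂ refl) (inj₁ refl) (inj₂ refl) _ = refl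
units-∣sum∣≡2⇒product≡-1 (inj₂ refl) (inj₂ refl) (inj₂ refl) (inj₁ refl) _ = refl
units-∣sum∣≡2⇒product≡-1 (inj₂ refl) (inj₂ refl) (inj₂ refl) (inj₂ refl) ()

dot-self-units : ∀ {n} {x : Vector ℤ n} → (∀ r → IsUnit (x r)) → dot x x ≡ + n
dot-self-units {n} x-unit = trans (Σ-cong n (unit² ∘ x-unit)) (Σ-one n)

apply : ∀ {n} → Matrix n → Vector ℤ n → Vector ℤ n
apply M x l = dot x (M l)

transpose : ∀ {n} → Matrix n → Matrix n
transpose M r l = M l r

dot-apply : ∀ {n} (M : Matrix n) (x z : Vector ℤ n) → dot (apply M x) z ≡ dot x (apply (transpose M) z)
dot-apply {n} M x z = begin
  Σ n (λ l → dot x (M l) *ℤ z l)                 ≡⟨ Σ-cong n (λ l → trans (ℤ.*-comm _ (z l)) (*-distribˡ-Σ n (z l) _)) ⟩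
  Σ n (λ l → Σ n (λ r → z l *ℤ (x r *ℤ M l r)))  ≡⟨ Σ-comm n n _ ⟩
  Σ n (λ r → Σ n (λ l → z l *ℤ (x r *ℤ M l r)))  ≡⟨ Σ-cong n (λ r → trans (Σ-cong n (λ l → swap (z l) (x r) (M l r)))
                                                                         (sym (*-distribˡ-Σ n (x r) _))) ⟩
  Σ n (λ r → x r *ℤ dot z (transpose M r))       ∎
  where
  swap : ∀ a b c → a *ℤ (b *ℤ c) ≡ b *ℤ (a *ℤ c)
  swap = solve 3 (λ a b c → a :* (b :* c) := b :* (a :* c)) refl

module Hadamard {n : ℕ} {H : Matrix n} (isH : IsHadamard n H) where

  entry-unit : ∀ u v → IsUnit (H u v)
  entry-unit = proj₁ isH

  rows-orthogonal : ∀ i j → dot (H i) (H j) ≡ + n *ℤ δ i j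
  rows-orthogonal i j = trans (proj₂ isH i j) (scaledId≡*δ n i j)

  apply-transpose : ∀ z l → apply H (apply (transpose H) z) l ≡ + n *ℤ z l
  apply-transpose z l = begin
    dot (apply (transpose H) z) (H l)   ≡⟨ dot-apply (transpose H) z (H l) ⟩
    dot z (λ j → dot (H l) (H j))       ≡⟨ dot-congʳ z (rows-orthogonal l) ⟩
    dot z (λ j → + n *ℤ δ l j)          ≡⟨ dot-scaleʳ (+ n) z (δ l) ⟩
    + n *ℤ dot z (δ l)                  ≡⟨ cong (+ n *ℤ_) (dot-δʳ l z) ⟩
    + n *ℤ z l                          ∎

  column-norm : ∀ r → dot (transpose H r) (transpose H r) ≡ + n
  column-norm r = dot-self-units (λ l → entry-unit l r)

  -- v = n·e_r − HᵀH e_r satisfies Hv = 0 (as HHᵀ = nI) and v_r = 0 (as columns have norm n),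
  -- so ⟨v, v⟩ = n·v_r − ⟨He_r, Hv⟩ = 0.
  columns-orthogonal : ∀ r s → dot (transpose H r) (transpose H s) ≡ + n *ℤ δ r s
  columns-orthogonal r s = sym (ℤ.i-j≡0⇒i≡j _ _ (dot-self≡0 v v·v≡0 s))
    where
    nδ w v : Vector ℤ n
    nδ s = + n *ℤ δ r s
    w = apply (transpose H) (transpose H r)
    v s = nδ s - w s

    nδ-dot : ∀ y → dot nδ y ≡ + n *ℤ y r
    nδ-dot y = trans (dot-scaleˡ (+ n) (δ r) y) (cong (+ n *ℤ_) (dot-δˡ r y))

    Hv≡0 : ∀ l → apply H v l ≡ 0ℤ
    Hv≡0 l = begin
      dot v (H l)                    ≡⟨ dot-subˡ nδ w (H l) ⟩
      dot nδ (H l) - dot w (H l)     ≡⟨ cong₂ _-_ (nδ-dot (H l)) (apply-transpose (transpose H r) l) ⟩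
      + n *ℤ H l r - + n *ℤ H l r    ≡⟨ ℤ.+-inverseʳ (+ n *ℤ H l r) ⟩
      0ℤ                             ∎

    v-r≡0 : v r ≡ 0ℤ
    v-r≡0 = begin
      + n *ℤ δ r r - w r   ≡⟨ cong₂ _-_ (trans (cong (+ n *ℤ_) (δ-refl r)) (ℤ.*-identityʳ (+ n))) (column-norm r) ⟩
      + n - + n            ≡⟨ ℤ.+-inverseʳ (+ n) ⟩
      0ℤ                   ∎

    v·v≡0 : dot v v ≡ 0ℤ
    v·v≡0 = begin
      dot v v               ≡⟨ dot-subˡ nδ w v ⟩
      dot nδ v - dot w v    ≡⟨ cong₂ _-_ (trans (nδ-dot v) (cong (+ n *ℤ_) v-r≡0))
                                         (trans (dot-apply (transpose H) (transpose H r) v)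
                                                (dot-zeroʳ (transpose H r) Hv≡0)) ⟩
      + n *ℤ 0ℤ - 0ℤ        ≡⟨ cong (_- 0ℤ) (ℤ.*-zeroʳ (+ n)) ⟩
      0ℤ                    ∎

  transpose-apply : ∀ x r → apply (transpose H) (apply H x) r ≡ + n *ℤ x r
  transpose-apply x r = begin
    dot (apply H x) (transpose H r)                        ≡⟨ dot-apply H x (transpose H r) ⟩
    dot x (λ s → dot (transpose H r) (transpose H s))      ≡⟨ dot-congʳ x (columns-orthogonal r) ⟩
    dot x (λ s → + n *ℤ δ r s)                             ≡⟨ dot-scaleʳ (+ n) x (δ r) ⟩
    + n *ℤ dot x (δ r)                                     ≡⟨ cong (+ n *ℤ_) (dot-δʳ r x) ⟩
    + n *ℤ x r                                             ∎

  parseval : ∀ x → dot (apply H x) (apply H x) ≡ + n *ℤ dot x x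
  parseval x = begin
    dot (apply H x) (apply H x)                   ≡⟨ dot-apply H x (apply H x) ⟩
    dot x (apply (transpose H) (apply H x))       ≡⟨ dot-congʳ x (transpose-apply x) ⟩
    dot x (λ r → + n *ℤ x r)                      ≡⟨ dot-scaleʳ (+ n) x x ⟩
    + n *ℤ dot x x                                ∎

IsUnitOrZero : ℤ → Set
IsUnitOrZero e = e ≡ 0ℤ ⊎ IsUnit e

record SupportEnumeration {m : ℕ} (e : Vector ℤ m) (k : ℕ) : Set where
  field
    index : Fin k → Fin m
    index-injective : ∀ p q → index p ≡ index q → p ≡ q
    unit-at : ∀ q → IsUnit (e (index q))
    dot-restrict : ∀ f → dot e f ≡ Σ k (λ q → e (index q) *ℤ f (index q))

module _ {m : ℕ} {e : Vector ℤ (suc m)} where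
  open SupportEnumeration

  support-cons-zero : ∀ {k} → e zero ≡ 0ℤ → SupportEnumeration (e ∘ suc) k → SupportEnumeration e k
  support-cons-zero {k} e₀≡0 s = record
    { index = suc ∘ index s
    ; index-injective = λ p q → index-injective s p q ∘ Fin.suc-injective
    ; unit-at = unit-at s
    ; dot-restrict = λ f → begin
        e zero *ℤ f zero +ℤ dot (e ∘ suc) (f ∘ suc)             ≡⟨ cong (λ e₀ → e₀ *ℤ f zero +ℤ dot (e ∘ suc) (f ∘ suc)) e₀≡0 ⟩
        0ℤ +ℤ dot (e ∘ suc) (f ∘ suc)                           ≡⟨ ℤ.+-identityˡ _ ⟩
        dot (e ∘ suc) (f ∘ suc)                                 ≡⟨ dot-restrict s (f ∘ suc) ⟩
        Σ k (λ q → e (suc (index s q)) *ℤ f (suc (index s q)))  ∎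
    }

  support-cons-unit : ∀ {k} → IsUnit (e zero) → SupportEnumeration (e ∘ suc) k → SupportEnumeration e (suc k)
  support-cons-unit e₀-unit s = record
    { index = index′
    ; index-injective = injective
    ; unit-at = λ { zero → e₀-unit ; (suc q) → unit-at s q }
    ; dot-restrict = λ f → cong (e zero *ℤ f zero +ℤ_) (dot-restrict s (f ∘ suc))
    }
    where
    index′ : Fin (suc _) → Fin (suc m)
    index′ zero = zero
    index′ (suc q) = suc (index s q)
    injective : ∀ p q → index′ p ≡ index′ q → p ≡ q
    injective zero zero _ = refl
    injective zero (suc _) ()
    injective (suc _) zero ()
    injective (suc p) (suc q) eq = cong suc (index-injective s p q (Fin.suc-injective eq))

1+i≡+k⇒k≡suc : ∀ {i k} → 0ℤ ≤ℤ i → 1ℤ +ℤ i ≡ + k → ∃[ k′ ] (k ≡ suc k′ × i ≡ + k′)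
1+i≡+k⇒k≡suc (+≤+ {n = k′} _) refl = k′ , refl , refl

support : ∀ {m} (e : Vector ℤ m) → (∀ l → IsUnitOrZero (e l)) → ∀ {k} → dot e e ≡ + k → SupportEnumeration e k
support {0} e _ {0} _ = record
  { index = λ () ; index-injective = λ () ; unit-at = λ () ; dot-restrict = λ _ → refl }
support {suc m} e e∈0±1 {k} e·e≡k with e∈0±1 zero
... | inj₁ e₀≡0 = support-cons-zero e₀≡0 (support (e ∘ suc) (e∈0±1 ∘ suc) rest≡k)
  where
  rest≡k : dot (e ∘ suc) (e ∘ suc) ≡ + k
  rest≡k = begin
    dot (e ∘ suc) (e ∘ suc)                      ≡⟨ ℤ.+-identityˡ _ ⟨
    0ℤ +ℤ dot (e ∘ suc) (e ∘ suc)                ≡⟨ cong (λ e₀ → e₀ *ℤ e₀ +ℤ dot (e ∘ suc) (e ∘ suc)) e₀≡0 ⟨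
    dot e e                                      ≡⟨ e·e≡k ⟩
    + k                                          ∎
... | inj₂ e₀-unit
  with 1+i≡+k⇒k≡suc (dot-self-nonneg (e ∘ suc)) (trans (cong (_+ℤ dot (e ∘ suc) (e ∘ suc)) (sym (unit² e₀-unit))) e·e≡k)
...   | k′ , refl , rest≡k′ = support-cons-unit e₀-unit (support (e ∘ suc) (e∈0±1 ∘ suc) rest≡k′)

∣i∣≡g⊎0⇒i≡g*e : ∀ {i g} → ∣ i ∣ ≡ g ⊎ ∣ i ∣ ≡ 0 → ∃[ e ] (IsUnitOrZero e × i ≡ + g *ℤ e)
∣i∣≡g⊎0⇒i≡g*e {+ m} (inj₁ refl) = 1ℤ , inj₂ (inj₁ refl) , sym (ℤ.*-identityʳ (+ m))
∣i∣≡g⊎0⇒i≡g*e { -[1+ m ]} (inj₁ refl) = -1ℤ , inj₂ (inj₂ refl) , sym (trans (ℤ.*-comm (+ suc m) -1ℤ) (ℤ.-1*i≡-i (+ suc m)))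
∣i∣≡g⊎0⇒i≡g*e {i} {g} (inj₂ ∣i∣≡0) = 0ℤ , inj₁ refl , trans (ℤ.∣i∣≡0⇒i≡0 ∣i∣≡0) (sym (ℤ.*-zeroʳ (+ g)))

module FullQuadruple
  {n g : ℕ} .{{_ : NonZero g}} {H : Matrix n} (isH : IsHadamard n H) (n≡2g : n ≡ 2 * g)
  {i j k : Fin n} (i≢j : i ≢ j) (i≢k : i ≢ k) (j≢k : j ≢ k)
  (P≡g⊎0 : ∀ l → Distinct4 i j k l → P n H i j k l ≡ g ⊎ P n H i j k l ≡ 0)
  where
  open Hadamard isH
  open SupportEnumeration

  x : Vector ℤ n
  x r = H i r *ℤ H j r *ℤ H k r

  x-unit : ∀ r → IsUnit (x r)
  x-unit r = unit-* (unit-* (entry-unit i r) (entry-unit j r)) (entry-unit k r)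

  c : Vector ℤ n
  c = apply H x

  c-vanishes : ∀ {a b} u l → a ≢ b → (∀ r → x r *ℤ H l r ≡ H u r *ℤ H u r *ℤ (H a r *ℤ H b r)) → c l ≡ 0ℤ
  c-vanishes {a} {b} u l a≢b regroup = begin
    dot x (H l)                                         ≡⟨ Σ-cong n regroup ⟩
    Σ n (λ r → H u r *ℤ H u r *ℤ (H a r *ℤ H b r))      ≡⟨ Σ-cong n (λ r → trans (cong (_*ℤ _) (unit² (entry-unit u r))) (ℤ.*-identityˡ _)) ⟩
    dot (H a) (H b)                                     ≡⟨ rows-orthogonal a b ⟩
    + n *ℤ δ a b                                        ≡⟨ cong (+ n *ℤ_) (δ-≢ a≢b) ⟩
    + n *ℤ 0ℤ                                           ≡⟨ ℤ.*-zeroʳ (+ n) ⟩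
    0ℤ                                                  ∎

  ∣c∣≡g⊎0 : ∀ l → ∣ c l ∣ ≡ g ⊎ ∣ c l ∣ ≡ 0
  ∣c∣≡g⊎0 l with l ≟ i | l ≟ j | l ≟ k
  ... | yes refl | _ | _ = inj₂ (cong ∣_∣ (c-vanishes i i j≢k (λ r →
    solve 3 (λ a b d → a :* b :* d :* a := a :* a :* (b :* d)) refl (H i r) (H j r) (H k r))))
  ... | no _ | yes refl | _ = inj₂ (cong ∣_∣ (c-vanishes j j i≢k (λ r →
    solve 3 (λ a b d → a :* b :* d :* b := b :* b :* (a :* d)) refl (H i r) (H j r) (H k r))))
  ... | no _ | no _ | yes refl = inj₂ (cong ∣_∣ (c-vanishes k k i≢j (λ r →
    solve 3 (λ a b d → a :* b :* d :* d := d :* d :* (a :* b)) refl (H i r) (H j r) (H k r))))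
  ... | no l≢i | no l≢j | no l≢k = P≡g⊎0 l (i≢j , i≢k , l≢i ∘ sym , j≢k , l≢j ∘ sym , l≢k ∘ sym)

  c-scaled : ∀ l → ∃[ e ] (IsUnitOrZero e × c l ≡ + g *ℤ e)
  c-scaled l = ∣i∣≡g⊎0⇒i≡g*e {c l} (∣c∣≡g⊎0 l)

  e : Vector ℤ n
  e = proj₁ ∘ c-scaled

  e∈0±1 : ∀ l → IsUnitOrZero (e l)
  e∈0±1 = proj₁ ∘ proj₂ ∘ c-scaled

  c≡g*e : ∀ l → c l ≡ + g *ℤ e l
  c≡g*e = proj₂ ∘ proj₂ ∘ c-scaled

  +n≡2*g : + n ≡ + 2 *ℤ + g
  +n≡2*g = trans (cong +_ n≡2g) (ℤ.pos-* 2 g)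

  e·e≡4 : dot e e ≡ + 4
  e·e≡4 = ℤ.*-cancelˡ-≡ (+ g) _ _ (ℤ.*-cancelˡ-≡ (+ g) _ _ (begin
    + g *ℤ (+ g *ℤ dot e e)                          ≡⟨ cong (+ g *ℤ_) (dot-scaleʳ (+ g) e e) ⟨
    + g *ℤ dot e (λ l → + g *ℤ e l)                  ≡⟨ dot-scaleˡ (+ g) e _ ⟨
    dot (λ l → + g *ℤ e l) (λ l → + g *ℤ e l)        ≡⟨ trans (dot-congˡ c c≡g*e) (dot-congʳ (λ l → + g *ℤ e l) c≡g*e) ⟨
    dot c c                                          ≡⟨ parseval x ⟩
    + n *ℤ dot x x                                   ≡⟨ cong (+ n *ℤ_) (dot-self-units x-unit) ⟩
    + n *ℤ + n                                       ≡⟨ cong₂ _*ℤ_ +n≡2*g +n≡2*g ⟩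
    (+ 2 *ℤ + g) *ℤ (+ 2 *ℤ + g)                     ≡⟨ solve 1 (λ g → (con (+ 2) :* g) :* (con (+ 2) :* g) := g :* (g :* con (+ 4))) refl (+ g) ⟩
    + g *ℤ (+ g *ℤ + 4)                              ∎))

  Hᵀe≡2x : ∀ r → dot e (transpose H r) ≡ + 2 *ℤ x r
  Hᵀe≡2x r = ℤ.*-cancelˡ-≡ (+ g) _ _ (begin
    + g *ℤ dot e (transpose H r)                ≡⟨ dot-scaleˡ (+ g) e _ ⟨
    dot (λ l → + g *ℤ e l) (transpose H r)      ≡⟨ dot-congˡ _ c≡g*e ⟨
    dot c (transpose H r)                       ≡⟨ transpose-apply x r ⟩
    + n *ℤ x r                                  ≡⟨ cong (_*ℤ x r) +n≡2*g ⟩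
    + 2 *ℤ + g *ℤ x r                           ≡⟨ solve 2 (λ g y → con (+ 2) :* g :* y := g :* (con (+ 2) :* y)) refl (+ g) (x r) ⟩
    + g *ℤ (+ 2 *ℤ x r)                         ∎)

  supp : SupportEnumeration e 4
  supp = support e e∈0±1 e·e≡4

  a : Fin 4 → Fin n
  a = index supp

  D : ℤ
  D = e (a 0F) *ℤ e (a 1F) *ℤ e (a 2F) *ℤ e (a 3F)

  D-unit : IsUnit D
  D-unit = unit-* (unit-* (unit-* (unit-at supp 0F) (unit-at supp 1F)) (unit-at supp 2F)) (unit-at supp 3F)

  row-product≡-D : ∀ r → H (a 0F) r *ℤ H (a 1F) r *ℤ H (a 2F) r *ℤ H (a 3F) r ≡ - D
  row-product≡-D r = unit*≡-1⇒≡-unit D-unit (begin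
    D *ℤ (h 0F *ℤ h 1F *ℤ h 2F *ℤ h 3F)   ≡⟨ solve 8 (λ e₀ e₁ e₂ e₃ h₀ h₁ h₂ h₃ →
                                              e₀ :* e₁ :* e₂ :* e₃ :* (h₀ :* h₁ :* h₂ :* h₃)
                                              := e₀ :* h₀ :* (e₁ :* h₁) :* (e₂ :* h₂) :* (e₃ :* h₃)) refl
                                              (e (a 0F)) (e (a 1F)) (e (a 2F)) (e (a 3F)) (h 0F) (h 1F) (h 2F) (h 3F) ⟩
    u 0F *ℤ u 1F *ℤ u 2F *ℤ u 3F          ≡⟨ units-∣sum∣≡2⇒product≡-1 (u-unit 0F) (u-unit 1F) (u-unit 2F) (u-unit 3F) ∣Σu∣≡2 ⟩
    -1ℤ                                   ∎)
    where
    h u : Fin 4 → ℤ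
    h q = H (a q) r
    u q = e (a q) *ℤ h q
    u-unit : ∀ q → IsUnit (u q)
    u-unit q = unit-* (unit-at supp q) (entry-unit (a q) r)
    ∣Σu∣≡2 : ∣ Σ 4 u ∣ ≡ 2
    ∣Σu∣≡2 = begin
      ∣ Σ 4 u ∣                     ≡⟨ cong ∣_∣ (dot-restrict supp (transpose H r)) ⟨
      ∣ dot e (transpose H r) ∣     ≡⟨ cong ∣_∣ (Hᵀe≡2x r) ⟩
      ∣ + 2 *ℤ x r ∣                ≡⟨ ℤ.abs-* (+ 2) (x r) ⟩
      2 * ∣ x r ∣                   ≡⟨ cong (2 *_) (∣unit∣≡1 (x-unit r)) ⟩
      2                             ∎

  P≡n : P n H (a 0F) (a 1F) (a 2F) (a 3F) ≡ n
  P≡n = begin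
    ∣ Σ n (λ r → H (a 0F) r *ℤ H (a 1F) r *ℤ H (a 2F) r *ℤ H (a 3F) r) ∣   ≡⟨ cong ∣_∣ (Σ-cong n row-product≡-D) ⟩
    ∣ Σ n (λ _ → - D) ∣                                                  ≡⟨ cong ∣_∣ (Σ-const n (- D)) ⟩
    ∣ - D *ℤ + n ∣                                                       ≡⟨ ℤ.abs-* (- D) (+ n) ⟩
    ∣ - D ∣ * n                                                          ≡⟨ cong (_* n) (trans (ℤ.∣-i∣≡∣i∣ D) (∣unit∣≡1 D-unit)) ⟩
    1 * n                                                                ≡⟨ ℕ.*-identityˡ n ⟩
    n                                                                    ∎

  a-distinct : Distinct4 (a 0F) (a 1F) (a 2F) (a 3F)
  a-distinct = apart 0F 1F (λ ()) , apart 0F 2F (λ ()) , apart 0F 3F (λ ()) ,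
               apart 1F 2F (λ ()) , apart 1F 3F (λ ()) , apart 2F 3F (λ ())
    where
    apart : ∀ p q → p ≢ q → a p ≢ a q
    apart p q p≢q = p≢q ∘ index-injective supp p q

  full-quadruple : Σ[ a₀ ∈ Fin n ] Σ[ a₁ ∈ Fin n ] Σ[ a₂ ∈ Fin n ] Σ[ a₃ ∈ Fin n ]
                    (Distinct4 a₀ a₁ a₂ a₃ × P n H a₀ a₁ a₂ a₃ ≡ n)
  full-quadruple = a 0F , a 1F , a 2F , a 3F , a-distinct , P≡n

P+8T≡n : ∀ n H (i j k l : Fin n) T → HasType n H i j k l T → P n H i j k l + 8 * T ≡ n
P+8T≡n n H i j k l T type-T = ℤ.+-injective (begin
  + p +ℤ + (8 * T)     ≡⟨ cong (+ p +ℤ_) type-T ⟨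
  + p +ℤ (+ n - + p)   ≡⟨ solve 2 (λ p n → p :+ (n :- p) := n) refl (+ p) (+ n) ⟩
  + n                  ∎)
  where
  p = P n H i j k l

P≡n⇒type≡0 : ∀ n H (i j k l : Fin n) T → P n H i j k l ≡ n → HasType n H i j k l T → T ≡ 0
P≡n⇒type≡0 n H i j k l T P≡n type-T = [ (λ ()) , id ]′ (ℕ.m*n≡0⇒m≡0∨n≡0 8 8T≡0)
  where
  8T≡0 : 8 * T ≡ 0
  8T≡0 = ℕ.+-cancelˡ-≡ n _ _ (trans (cong (_+ 8 * T) (sym P≡n)) (trans (P+8T≡n n H i j k l T type-T) (sym (ℕ.+-identityʳ n))))

type-t⊎2t⇒P≡8t⊎0 : ∀ t (H : Matrix (16 * t)) i j k l →
  HasType (16 * t) H i j k l t ⊎ HasType (16 * t) H i j k l (2 * t) →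
  P (16 * t) H i j k l ≡ 8 * t ⊎ P (16 * t) H i j k l ≡ 0
type-t⊎2t⇒P≡8t⊎0 t H i j k l (inj₁ type-t) =
  inj₁ (ℕ.+-cancelʳ-≡ (8 * t) _ _ (trans (P+8T≡n (16 * t) H i j k l t type-t) (ℕ.*-distribʳ-+ t 8 8)))
type-t⊎2t⇒P≡8t⊎0 t H i j k l (inj₂ type-2t) =
  inj₂ (ℕ.+-cancelʳ-≡ (16 * t) _ _ (trans (cong (λ m → P (16 * t) H i j k l + m) (ℕ.*-assoc 8 2 t))
                                            (P+8T≡n (16 * t) H i j k l (2 * t) type-2t)))

three-distinct : ∀ {m} → 3 ≤ m → Σ[ i ∈ Fin m ] Σ[ j ∈ Fin m ] Σ[ k ∈ Fin m ] (i ≢ j × i ≢ k × j ≢ k)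
three-distinct (s≤s (s≤s (s≤s _))) = 0F , 1F , 2F , (λ ()) , (λ ()) , (λ ())

theorem3p2 : (t : ℕ) → 0 Data.Nat.< t →
    ¬ (Σ[ H ∈ Matrix (16 * t) ] (IsHadamard (16 * t) H
        × (∀ i j k l → Distinct4 i j k l →
             HasType (16 * t) H i j k l t ⊎ HasType (16 * t) H i j k l (2 * t))))
theorem3p2 t 0<t (H , isH , types) =
  let i , j , k , i≢j , i≢k , j≢k = three-distinct (ℕ.≤-trans (s≤s (s≤s (s≤s z≤n))) (ℕ.m≤m*n 16 t))
      a₀ , a₁ , a₂ , a₃ , distinct , P≡n =
        FullQuadruple.full-quadruple {g = 8 * t} isH (ℕ.*-assoc 2 8 t) i≢j i≢k j≢k
          (λ l distinct → type-t⊎2t⇒P≡8t⊎0 t H i j k l (types i j k l distinct))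
  in [ ≢-nonZero⁻¹ t ∘ P≡n⇒type≡0 (16 * t) H a₀ a₁ a₂ a₃ t P≡n
     , ≢-nonZero⁻¹ (2 * t) ∘ P≡n⇒type≡0 (16 * t) H a₀ a₁ a₂ a₃ (2 * t) P≡n
     ]′ (types a₀ a₁ a₂ a₃ distinct)
  where
  instance
    t≢0 : NonZero t
    t≢0 = >-nonZero 0<t
    8t≢0 : NonZero (8 * t)
    8t≢0 = ℕ.m*n≢0 8 t
    2t≢0 : NonZero (2 * t)
    2t≢0 = ℕ.m*n≢0 2 t
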